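{- The following posets are lattices: (i) $\mathcal{Z}_{n,k}$, the set of strong compositions of $k$ with at most $n$ parts under the dominance order; (ii) $\mathcal{I}_{n,k}$, the set of weak compositions $\alpha\in\mathbb{N}^n$ with $|\alpha|=k$ under the dominance order; (iii) $\mathcal{L}_{n,k}$, the set $L_{n,k}=\{\alpha\in\mathbb{N}^n:|\alpha|=k,\ \alpha_i\le n-i\text{ for all }1\le i\le n\}$ under the dominance order.
   Context: Dominance order on compositions of the same integer $k$ (padded with zeros to a common length): $\alpha\unlhd\beta$ iff $\alpha_1+\cdots+\alpha_i\ge\beta_1+\cdots+\beta_i$ for all $i$. A strong composition has all parts positive. Equivalently, $L_{n,k}$ is the set of Lehmer codes $c_i(w)=\#\{j>i:w(j)<w(i)\}$ of permutations $w\in S_n$ with $k$ inversions. -}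

module Defs where

open import Data.Nat using (ℕ; _≤_; _∸_; suc)
open import Data.List using (List; take; length)
open import Data.Nat.ListAction using (sum)
open import Data.List.Relation.Unary.All using (All)
open import Data.Vec using (Vec; toList; lookup)
open import Data.Fin using (Fin; toℕ)
open import Data.Product using (Σ; ∃; ∃₂; _×_; proj₁)
open import Relation.Binary.PropositionalEquality using (_≡_)
open import Relation.Binary.Lattice.Structures using (IsLattice)

-- Partial sum α₁ + ⋯ + αᵢ. For i beyond the length, take returns the whole list,
-- which is the same as padding with zeros.
psum : List ℕ → ℕ → ℕ
psum α i = sum (take i α)

_⊴_ : List ℕ → List ℕ → Set
α ⊴ β = ∀ i → psum β i ≤ psum α i

IsLatticeOn : {A : Set} → (A → A → Set) → (A → Set) → Set
IsLatticeOn {A} _≤_ S =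
  ∃₂ λ (_∨_ _∧_ : Σ A S → Σ A S → Σ A S) →
    IsLattice (λ x y → proj₁ x ≡ proj₁ y) (λ x y → proj₁ x ≤ proj₁ y) _∨_ _∧_

Z : ℕ → ℕ → List ℕ → Set
Z n k α = All (λ a → 1 ≤ a) α × length α ≤ n × sum α ≡ k

_⊴ᵛ_ : ∀ {n} → Vec ℕ n → Vec ℕ n → Set
α ⊴ᵛ β = toList α ⊴ toList β

I : (n : ℕ) → ℕ → Vec ℕ n → Set
I n k α = sum (toList α) ≡ k

-- L_{n,k}: α ∈ ℕⁿ with |α| = k and α_i ≤ n - i (1-indexed; i ↦ toℕ i + 1).
L : (n : ℕ) → ℕ → Vec ℕ n → Set
L n k α = sum (toList α) ≡ k × (∀ (i : Fin n) → lookup α i ≤ n ∸ suc (toℕ i))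

{-# OPTIONS --safe #-}
module Submission where

-- Dominance is the reverse of the pointwise order on partial-sum sequences, and in
-- each of the three posets an element is determined by its partial sums. So it
-- suffices that each set is closed under taking pointwise minima (joins) and maxima
-- (meets) of partial sums. Both are again monotone sequences starting at 0 and
-- ending at k, so their difference sequences are compositions of k. If two sequences
-- both increase by at most B at some step, so do their minimum and maximum; this
-- preserves the bounds αᵢ ≤ n − i of L_{n,k}. For strong compositions the minimum
-- increases strictly up to the larger of the two lengths and the maximum up to the
-- smaller one, which are therefore the lengths of the join and the meet.

open import Defs
open import Data.Nat using (ℕ; zero; suc; _+_; _∸_; _≤_; _<_; _⊓_; _⊔_; z≤n; s≤s; _≤?_)
open import Data.Nat.Properties
open import Data.Nat.ListAction using (sum)
open import Data.List using (List; []; _∷_; length)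
open import Data.List.Properties using (take-all)
open import Data.List.Relation.Unary.All using (All; []; _∷_)
open import Data.Vec using (Vec; toList; lookup; tabulate) renaming ([] to []ᵛ; _∷_ to _∷ᵛ_)
open import Data.Vec.Properties using (length-toList; lookup∘tabulate)
open import Data.Fin using (Fin; toℕ) renaming (zero to fzero; suc to fsuc)
open import Data.Product using (Σ; Σ-syntax; _×_; _,_; proj₁; proj₂)
open import Data.Sum using (inj₁; inj₂)
open import Function using (_∘_)
open import Relation.Binary.Core using (_Preserves_⟶_; _Preserves₂_⟶_⟶_)
open import Relation.Binary.PropositionalEquality
open import Relation.Nullary using (yes; no; contradiction)

Settles : (ℕ → ℕ) → ℕ → ℕ → Set
Settles h L v = ∀ {i} → L ≤ i → h i ≡ v

PointwiseClosed : {A : Set} → (A → ℕ → ℕ) → (ℕ → ℕ → ℕ) → (A → Set) → Set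
PointwiseClosed {A} P _∙_ S =
  ∀ (x y : Σ A S) → Σ[ z ∈ Σ A S ] P (proj₁ z) ≗ λ i → P (proj₁ x) i ∙ P (proj₁ y) i

profile-isLatticeOn : {A : Set} {S : A → Set} (P : A → ℕ → ℕ) →
  (∀ {x y} → S x → S y → P x ≗ P y → x ≡ y) →
  PointwiseClosed P _⊓_ S → PointwiseClosed P _⊔_ S →
  IsLatticeOn (λ a b → ∀ i → P b i ≤ P a i) S
profile-isLatticeOn P injective min max =
  (λ x y → proj₁ (min x y)) , (λ x y → proj₁ (max x y)) , record
  { isPartialOrder = record
    { isPreorder = record
      { isEquivalence = record { refl = refl ; sym = sym ; trans = trans }
      ; reflexive     = λ x≡y i → ≤-reflexive (cong (λ z → P z i) (sym x≡y))
      ; trans         = λ x≤y y≤z i → ≤-trans (y≤z i) (x≤y i)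
      }
    ; antisym = λ {x} {y} x≤y y≤x → injective (proj₂ x) (proj₂ y) (λ i → ≤-antisym (y≤x i) (x≤y i))
    }
  ; supremum = λ x y →
      (λ i → ≤-trans (≤-reflexive (proj₂ (min x y) i)) (m⊓n≤m _ _)) ,
      (λ i → ≤-trans (≤-reflexive (proj₂ (min x y) i)) (m⊓n≤n _ _)) ,
      (λ z x≤z y≤z i → ≤-trans (⊓-glb (x≤z i) (y≤z i)) (≤-reflexive (sym (proj₂ (min x y) i))))
  ; infimum = λ x y →
      (λ i → ≤-trans (m≤m⊔n _ _) (≤-reflexive (sym (proj₂ (max x y) i)))) ,
      (λ i → ≤-trans (m≤n⊔m _ _) (≤-reflexive (sym (proj₂ (max x y) i)))) ,
      (λ z z≤x z≤y i → ≤-trans (≤-reflexive (proj₂ (max x y) i)) (⊔-lub (z≤x i) (z≤y i)))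
  }

psum-mono : ∀ α → psum α Preserves _≤_ ⟶ _≤_
psum-mono []      {zero}  _         = z≤n
psum-mono []      {suc _} (s≤s _)   = z≤n
psum-mono (x ∷ α) z≤n               = z≤n
psum-mono (x ∷ α) (s≤s i≤j)         = +-monoʳ-≤ x (psum-mono α i≤j)

psum-settles : ∀ α → Settles (psum α) (length α) (sum α)
psum-settles α {i} ℓ≤i = cong sum (take-all i α ℓ≤i)

psum-≤-sum : ∀ α i → psum α i ≤ sum α
psum-≤-sum α i = ≤-trans (psum-mono α (m≤m⊔n i (length α)))
                         (≤-reflexive (psum-settles α (m≤n⊔m i (length α))))

psum-strict : ∀ {α} → All (1 ≤_) α → ∀ {j} → j < length α → psum α j < psum α (suc j)
psum-strict {x ∷ _} (1≤x ∷ _)  {zero}  _         = m≤n⇒m≤n+o 0 1≤x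
psum-strict {x ∷ _} (_   ∷ α⁺) {suc j} (s≤s j<ℓ) = +-monoʳ-< x (psum-strict α⁺ j<ℓ)

psum-<-sum : ∀ {α} → All (1 ≤_) α → ∀ {j} → j < length α → psum α j < sum α
psum-<-sum {α} α⁺ {j} j<ℓ = <-≤-trans (psum-strict α⁺ j<ℓ) (psum-≤-sum α (suc j))

psum-∷-injective : ∀ {x y α β} → psum (x ∷ α) ≗ psum (y ∷ β) → x ≡ y × psum α ≗ psum β
psum-∷-injective {x} {y} {α} {β} eq =
  x≡y , λ i → +-cancelˡ-≡ x _ _ (trans (eq (suc i)) (cong (_+ psum β i) (sym x≡y)))
  where
  x≡y : x ≡ y
  x≡y = trans (sym (+-identityʳ x)) (trans (eq 1) (+-identityʳ y))

psum-injective : ∀ {α β} → All (1 ≤_) α → All (1 ≤_) β → psum α ≗ psum β → α ≡ β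
psum-injective []          []          _  = refl
psum-injective []          (1≤y ∷ _)   eq = contradiction (eq 1) (<⇒≢ (m≤n⇒m≤n+o 0 1≤y))
psum-injective (1≤x ∷ _)   []          eq = contradiction (sym (eq 1)) (<⇒≢ (m≤n⇒m≤n+o 0 1≤x))
psum-injective (_   ∷ α⁺)  (_   ∷ β⁺)  eq =
  let x≡y , eq′ = psum-∷-injective eq in cong₂ _∷_ x≡y (psum-injective α⁺ β⁺ eq′)

psum∘toList-injective : ∀ {n} (a b : Vec ℕ n) → psum (toList a) ≗ psum (toList b) → a ≡ b
psum∘toList-injective []ᵛ       []ᵛ       _  = refl
psum∘toList-injective (x ∷ᵛ a) (y ∷ᵛ b) eq =
  let x≡y , eq′ = psum-∷-injective eq in cong₂ _∷ᵛ_ x≡y (psum∘toList-injective a b eq′)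

lookup≡psum-increment : ∀ {n} (a : Vec ℕ n) j →
  lookup a j ≡ psum (toList a) (suc (toℕ j)) ∸ psum (toList a) (toℕ j)
lookup≡psum-increment (x ∷ᵛ a) fzero    = sym (+-identityʳ x)
lookup≡psum-increment (x ∷ᵛ a) (fsuc j) =
  trans (lookup≡psum-increment a j) (sym ([m+n]∸[m+o]≡n∸o x _ _))

differences : (ℕ → ℕ) → (L : ℕ) → Vec ℕ L
differences h L = tabulate λ j → h (suc (toℕ j)) ∸ h (toℕ j)

[n∸m]+[o∸n]≡o∸m : ∀ {m n o} → m ≤ n → n ≤ o → (n ∸ m) + (o ∸ n) ≡ o ∸ m
[n∸m]+[o∸n]≡o∸m {m} {n} {o} m≤n n≤o = begin
  (n ∸ m) + (o ∸ n) ≡⟨ +-comm (n ∸ m) (o ∸ n) ⟩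
  (o ∸ n) + (n ∸ m) ≡⟨ sym (+-∸-assoc (o ∸ n) m≤n) ⟩
  (o ∸ n) + n ∸ m   ≡⟨ cong (_∸ m) (m∸n+n≡m n≤o) ⟩
  o ∸ m             ∎
  where open ≡-Reasoning

psum-differences : ∀ {h} → h Preserves _≤_ ⟶ _≤_ →
  ∀ L i → psum (toList (differences h L)) i ≡ h (i ⊓ L) ∸ h 0
psum-differences {h} _    zero    zero    = sym (n∸n≡0 (h 0))
psum-differences {h} _    zero    (suc i) = sym (n∸n≡0 (h 0))
psum-differences {h} _    (suc L) zero    = sym (n∸n≡0 (h 0))
psum-differences {h} mono (suc L) (suc i) = begin
  (h 1 ∸ h 0) + psum (toList (differences (h ∘ suc) L)) i
    ≡⟨ cong ((h 1 ∸ h 0) +_) (psum-differences (mono ∘ s≤s) L i) ⟩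
  (h 1 ∸ h 0) + (h (suc (i ⊓ L)) ∸ h 1)
    ≡⟨ [n∸m]+[o∸n]≡o∸m (mono z≤n) (mono (s≤s z≤n)) ⟩
  h (suc (i ⊓ L)) ∸ h 0
    ∎
  where open ≡-Reasoning

module _ {h : ℕ → ℕ} {L v : ℕ}
  (mono : h Preserves _≤_ ⟶ _≤_) (h0≡0 : h 0 ≡ 0) (settles : Settles h L v) where

  psum-differences-settled : psum (toList (differences h L)) ≗ h
  psum-differences-settled i = begin
    psum (toList (differences h L)) i ≡⟨ psum-differences mono L i ⟩
    h (i ⊓ L) ∸ h 0                   ≡⟨ cong (h (i ⊓ L) ∸_) h0≡0 ⟩
    h (i ⊓ L)                         ≡⟨ h[i⊓L]≡h[i] ⟩
    h i                               ∎
    where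
    open ≡-Reasoning
    h[i⊓L]≡h[i] : h (i ⊓ L) ≡ h i
    h[i⊓L]≡h[i] with ≤-total i L
    ... | inj₁ i≤L = cong h (m≤n⇒m⊓n≡m i≤L)
    ... | inj₂ L≤i = trans (cong h (m≥n⇒m⊓n≡n L≤i)) (trans (settles ≤-refl) (sym (settles L≤i)))

  sum-differences-settled : sum (toList (differences h L)) ≡ v
  sum-differences-settled = begin
    sum (toList (differences h L))    ≡⟨ sym (psum-settles (toList (differences h L)) ℓ≤L) ⟩
    psum (toList (differences h L)) L ≡⟨ psum-differences-settled L ⟩
    h L                               ≡⟨ settles ≤-refl ⟩
    v                                 ∎
    where
    open ≡-Reasoning
    ℓ≤L : length (toList (differences h L)) ≤ L
    ℓ≤L = ≤-reflexive (length-toList (differences h L))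

differences-positive : ∀ {h} L → (∀ {j} → j < L → h j < h (suc j)) →
  All (1 ≤_) (toList (differences h L))
differences-positive zero    _      = []
differences-positive (suc L) strict =
  m<n⇒0<n∸m (strict (s≤s z≤n)) ∷ differences-positive L (strict ∘ s≤s)

⊔-settlesˡ : ∀ {f g : ℕ → ℕ} {L v} →
  Settles f L v → (∀ i → g i ≤ v) → Settles (λ i → f i ⊔ g i) L v
⊔-settlesˡ {f} {g} f-settles g≤v {i} L≤i =
  trans (m≥n⇒m⊔n≡m (subst (g i ≤_) (sym (f-settles L≤i)) (g≤v i))) (f-settles L≤i)

⊔-settlesʳ : ∀ {f g : ℕ → ℕ} {L v} →
  (∀ i → f i ≤ v) → Settles g L v → Settles (λ i → f i ⊔ g i) L v
⊔-settlesʳ {f} {g} f≤v g-settles {i} L≤i =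
  trans (m≤n⇒m⊔n≡n (subst (f i ≤_) (sym (g-settles L≤i)) (f≤v i))) (g-settles L≤i)

⊓-increment-≤ : ∀ s s′ t t′ {B} → s′ ∸ s ≤ B → t′ ∸ t ≤ B → (s′ ⊓ t′) ∸ (s ⊓ t) ≤ B
⊓-increment-≤ s s′ t t′ ds dt with ≤-total s t
... | inj₁ s≤t rewrite m≤n⇒m⊓n≡m s≤t = ≤-trans (∸-monoˡ-≤ s (m⊓n≤m s′ t′)) ds
... | inj₂ t≤s rewrite m≥n⇒m⊓n≡n t≤s = ≤-trans (∸-monoˡ-≤ t (m⊓n≤n s′ t′)) dt

⊔-increment-≤ : ∀ s s′ t t′ {B} → s′ ∸ s ≤ B → t′ ∸ t ≤ B → (s′ ⊔ t′) ∸ (s ⊔ t) ≤ B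
⊔-increment-≤ s s′ t t′ ds dt with ≤-total s′ t′
... | inj₁ s′≤t′ rewrite m≤n⇒m⊔n≡n s′≤t′ = ≤-trans (∸-monoʳ-≤ t′ (m≤n⊔m s t)) dt
... | inj₂ t′≤s′ rewrite m≥n⇒m⊔n≡m t′≤s′ = ≤-trans (∸-monoʳ-≤ s′ (m≤m⊔n s t)) ds

module VectorCombination {n : ℕ} (_∙_ : ℕ → ℕ → ℕ)
  (∙-mono : _∙_ Preserves₂ _≤_ ⟶ _≤_ ⟶ _≤_) (∙-idem : ∀ x → x ∙ x ≡ x)
  (∙-increment-≤ : ∀ s s′ t t′ {B} → s′ ∸ s ≤ B → t′ ∸ t ≤ B → (s′ ∙ t′) ∸ (s ∙ t) ≤ B)
  (a b : Vec ℕ n) where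

  profile : ℕ → ℕ
  profile i = psum (toList a) i ∙ psum (toList b) i

  combine : Vec ℕ n
  combine = differences profile n

  private
    profile-mono : profile Preserves _≤_ ⟶ _≤_
    profile-mono i≤j = ∙-mono (psum-mono (toList a) i≤j) (psum-mono (toList b) i≤j)

    settles : Settles profile n (sum (toList a) ∙ sum (toList b))
    settles n≤i = cong₂ _∙_ (psum-settles (toList a) (≤-trans (≤-reflexive (length-toList a)) n≤i))
                            (psum-settles (toList b) (≤-trans (≤-reflexive (length-toList b)) n≤i))

  psum-combine : psum (toList combine) ≗ profile
  psum-combine = psum-differences-settled profile-mono (∙-idem 0) settles

  sum-combine : ∀ {k} → I n k a → I n k b → I n k combine
  sum-combine {k} Σa≡k Σb≡k = begin
    sum (toList combine)           ≡⟨ sum-differences-settled profile-mono (∙-idem 0) settles ⟩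
    sum (toList a) ∙ sum (toList b) ≡⟨ cong₂ _∙_ Σa≡k Σb≡k ⟩
    k ∙ k                          ≡⟨ ∙-idem k ⟩
    k                              ∎
    where open ≡-Reasoning

  lookup-combine-≤ : ∀ (B : Fin n → ℕ) → (∀ j → lookup a j ≤ B j) → (∀ j → lookup b j ≤ B j) →
    ∀ j → lookup combine j ≤ B j
  lookup-combine-≤ B a≤B b≤B j = begin
    lookup combine j                        ≡⟨ lookup∘tabulate _ j ⟩
    profile (suc (toℕ j)) ∸ profile (toℕ j) ≤⟨ ∙-increment-≤ _ _ _ _ (increment≤B a (a≤B j))
                                                                      (increment≤B b (b≤B j)) ⟩
    B j                                     ∎
    where
    open ≤-Reasoning
    increment≤B : ∀ c → lookup c j ≤ B j →
      psum (toList c) (suc (toℕ j)) ∸ psum (toList c) (toℕ j) ≤ B j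
    increment≤B c = subst (_≤ B j) (lookup≡psum-increment c j)

module Min {n} = VectorCombination {n} _⊓_ ⊓-mono-≤ ⊓-idem ⊓-increment-≤
module Max {n} = VectorCombination {n} _⊔_ ⊔-mono-≤ ⊔-idem ⊔-increment-≤

⊴ᵛ-isLatticeOn : ∀ {n} {S : Vec ℕ n → Set} →
  (∀ a b → S a → S b → S (Min.combine a b)) → (∀ a b → S a → S b → S (Max.combine a b)) →
  IsLatticeOn (_⊴ᵛ_ {n}) S
⊴ᵛ-isLatticeOn min-closed max-closed = profile-isLatticeOn (psum ∘ toList)
  (λ {a} {b} _ _ → psum∘toList-injective a b)
  (λ (a , a∈S) (b , b∈S) → (Min.combine a b , min-closed a b a∈S b∈S) , Min.psum-combine a b)
  (λ (a , a∈S) (b , b∈S) → (Max.combine a b , max-closed a b a∈S b∈S) , Max.psum-combine a b)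

I-isLattice : ∀ n k → IsLatticeOn (_⊴ᵛ_ {n}) (I n k)
I-isLattice n k = ⊴ᵛ-isLatticeOn (λ a b → Min.sum-combine a b) (λ a b → Max.sum-combine a b)

L-isLattice : ∀ n k → IsLatticeOn (_⊴ᵛ_ {n}) (L n k)
L-isLattice n k = ⊴ᵛ-isLatticeOn
  (λ a b (Σa≡k , a≤B) (Σb≡k , b≤B) →
     Min.sum-combine a b Σa≡k Σb≡k , Min.lookup-combine-≤ a b B a≤B b≤B)
  (λ a b (Σa≡k , a≤B) (Σb≡k , b≤B) →
     Max.sum-combine a b Σa≡k Σb≡k , Max.lookup-combine-≤ a b B a≤B b≤B)
  where
  B : Fin n → ℕ
  B j = n ∸ suc (toℕ j)

⊓-psum-<-psum-suc : ∀ {a b} → All (1 ≤_) a → All (1 ≤_) b → sum a ≡ sum b →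
  ∀ {j} → j < length a ⊔ length b → psum a j ⊓ psum b j < psum a (suc j)
⊓-psum-<-psum-suc {a} {b} a⁺ b⁺ Σa≡Σb {j} j<ℓ with length a ≤? j
... | no  ℓa≰j = ≤-<-trans (m⊓n≤m _ _) (psum-strict a⁺ (≰⇒> ℓa≰j))
... | yes ℓa≤j = begin-strict
  psum a j ⊓ psum b j ≤⟨ m⊓n≤n _ _ ⟩
  psum b j            <⟨ psum-<-sum b⁺ j<ℓb ⟩
  sum b               ≡⟨ sym Σa≡Σb ⟩
  sum a               ≡⟨ sym (psum-settles a (m≤n⇒m≤1+n ℓa≤j)) ⟩
  psum a (suc j)      ∎
  where
  open ≤-Reasoning
  j<ℓb : j < length b
  j<ℓb = ≰⇒> λ ℓb≤j → <⇒≱ j<ℓ (⊔-lub ℓa≤j ℓb≤j)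

module StrongCombination {k : ℕ} {a b : List ℕ} (a⁺ : All (1 ≤_) a) (b⁺ : All (1 ≤_) b)
  (Σa≡k : sum a ≡ k) (Σb≡k : sum b ≡ k) where

  min max : ℕ → ℕ
  min i = psum a i ⊓ psum b i
  max i = psum a i ⊔ psum b i

  join meet : List ℕ
  join = toList (differences min (length a ⊔ length b))
  meet = toList (differences max (length a ⊓ length b))

  private
    psum-a-settles : Settles (psum a) (length a) k
    psum-a-settles ℓ≤i = trans (psum-settles a ℓ≤i) Σa≡k

    psum-b-settles : Settles (psum b) (length b) k
    psum-b-settles ℓ≤i = trans (psum-settles b ℓ≤i) Σb≡k

    psum-a-≤ : ∀ i → psum a i ≤ k
    psum-a-≤ i = ≤-trans (psum-≤-sum a i) (≤-reflexive Σa≡k)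

    psum-b-≤ : ∀ i → psum b i ≤ k
    psum-b-≤ i = ≤-trans (psum-≤-sum b i) (≤-reflexive Σb≡k)

    min-mono : min Preserves _≤_ ⟶ _≤_
    min-mono i≤j = ⊓-mono-≤ (psum-mono a i≤j) (psum-mono b i≤j)

    max-mono : max Preserves _≤_ ⟶ _≤_
    max-mono i≤j = ⊔-mono-≤ (psum-mono a i≤j) (psum-mono b i≤j)

    min-settles : Settles min (length a ⊔ length b) k
    min-settles ℓ≤i = trans (cong₂ _⊓_ (psum-a-settles (≤-trans (m≤m⊔n _ _) ℓ≤i))
                                       (psum-b-settles (≤-trans (m≤n⊔m _ _) ℓ≤i)))
                            (⊓-idem k)

    max-settles : Settles max (length a ⊓ length b) k
    max-settles {i} ℓ≤i with ⊓-sel (length a) (length b)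
    ... | inj₁ ℓ≡ℓa = ⊔-settlesˡ psum-a-settles psum-b-≤ (subst (_≤ i) ℓ≡ℓa ℓ≤i)
    ... | inj₂ ℓ≡ℓb = ⊔-settlesʳ psum-a-≤ psum-b-settles (subst (_≤ i) ℓ≡ℓb ℓ≤i)

    min-strict : ∀ {j} → j < length a ⊔ length b → min j < min (suc j)
    min-strict {j} j<ℓ = ⊓-glb (⊓-psum-<-psum-suc a⁺ b⁺ Σa≡Σb j<ℓ)
      (subst (_< psum b (suc j)) (⊓-comm (psum b j) (psum a j))
        (⊓-psum-<-psum-suc b⁺ a⁺ (sym Σa≡Σb) (subst (j <_) (⊔-comm (length a) (length b)) j<ℓ)))
      where Σa≡Σb = trans Σa≡k (sym Σb≡k)

    max-strict : ∀ {j} → j < length a ⊓ length b → max j < max (suc j)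
    max-strict j<ℓ = ⊔-mono-< (psum-strict a⁺ (<-≤-trans j<ℓ (m⊓n≤m _ _)))
                              (psum-strict b⁺ (<-≤-trans j<ℓ (m⊓n≤n _ _)))

  psum-join : psum join ≗ min
  psum-join = psum-differences-settled min-mono refl min-settles

  psum-meet : psum meet ≗ max
  psum-meet = psum-differences-settled max-mono refl max-settles

  sum-join : sum join ≡ k
  sum-join = sum-differences-settled min-mono refl min-settles

  sum-meet : sum meet ≡ k
  sum-meet = sum-differences-settled max-mono refl max-settles

  join-strong : All (1 ≤_) join
  join-strong = differences-positive _ min-strict

  meet-strong : All (1 ≤_) meet
  meet-strong = differences-positive _ max-strict

  length-join : length join ≡ length a ⊔ length b
  length-join = length-toList (differences min _)

  length-meet : length meet ≡ length a ⊓ length b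
  length-meet = length-toList (differences max _)

Z-isLattice : ∀ n k → IsLatticeOn _⊴_ (Z n k)
Z-isLattice n k = profile-isLatticeOn psum (λ (a⁺ , _) (b⁺ , _) → psum-injective a⁺ b⁺) joinᶻ meetᶻ
  where
  joinᶻ : PointwiseClosed psum _⊓_ (Z n k)
  joinᶻ (a , a⁺ , ℓa≤n , Σa≡k) (b , b⁺ , ℓb≤n , Σb≡k) =
    (join , join-strong , subst (_≤ n) (sym length-join) (⊔-lub ℓa≤n ℓb≤n) , sum-join)
    , psum-join
    where open StrongCombination a⁺ b⁺ Σa≡k Σb≡k

  meetᶻ : PointwiseClosed psum _⊔_ (Z n k)
  meetᶻ (a , a⁺ , ℓa≤n , Σa≡k) (b , b⁺ , _ , Σb≡k) =
    (meet , meet-strong , subst (_≤ n) (sym length-meet) (≤-trans (m⊓n≤m _ _) ℓa≤n) , sum-meet)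
    , psum-meet
    where open StrongCombination a⁺ b⁺ Σa≡k Σb≡k

proposition9p1 : (n k : ℕ) →
    IsLatticeOn _⊴_ (Z n k) × IsLatticeOn (_⊴ᵛ_ {n}) (I n k) × IsLatticeOn (_⊴ᵛ_ {n}) (L n k)
proposition9p1 n k = Z-isLattice n k , I-isLattice n k , L-isLattice n k
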